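{- Let $w\in\mathfrak{S}_N$. If there exist distinct $k,k'\in\mathrm{newrep}(w)$ with $\mathfrak{p}_k(w)=\mathfrak{p}_{k'}(w)$, then $w$ has an $N$-occurrence of $4321$.
   Context: Permutations are written in one-line notation; $s_i$ is the simple reflection interchanging $i$ and $i+1$; $\mathrm{supp}(u)$ is the set of distinct simple reflections appearing in a reduced decomposition of $u$. An occurrence of a pattern $p\in\mathfrak{S}_k$ in $w$ is a subsequence $w(i_1)\cdots w(i_k)$, $i_1<\cdots<i_k$, in the same relative order as $p$; it is identified with its set of values $\{w(i_1),\dots,w(i_k)\}$, and is an $N$-occurrence if its largest value is $N$. For $w\in\mathfrak{S}_N$, $\overline{w}\in\mathfrak{S}_{N-1}$ is obtained by deleting the letter $N$ from the one-line notation of $w$. For $u\in\mathfrak{S}_n$ and $1\le k\le n-1$, $M_k(u)=\max\{u(1),\dots,u(k)\}$, $m_k(u)=\min\{u(k+1),\dots,u(n)\}$; write $M_k=M_k(\overline{w})$, $m_k=m_k(\overline{w})$. Let $\mathrm{newrep}(w)=\{k:\ s_k\in\mathrm{supp}(\overline{w}),\ w^{ -1}(N)\le k\}$. For $k\in\mathrm{newrep}(w)$ define: (I) if $w^{ -1}(N)<w^{ -1}(M_k)$, $\mathfrak{p}_k(w)=\{N,M_k,m_k\}$ (an $N$-occurrence of $321$); (II) if $w^{ -1}(N)>w^{ -1}(M_k)$ and $\overline{w}(k)>m_k$, $\mathfrak{p}_k(w)=\{N,\overline{w}(k),m_k\}$ (an $N$-occurrence of $321$); (III) otherwise $\mathfrak{p}_k(w)=\{M_k,N,\overline{w}(k),m_k\}$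 (an $N$-occurrence of $3412$). -}

module Defs where

open import Data.Nat using (ℕ; zero; suc; _≤_; _<_; _<?_; _<ᵇ_; _≡ᵇ_; _⊔_; _⊓_; _∸_; _+_)
open import Data.Fin using (Fin; toℕ; fromℕ<)
open import Data.Fin.Permutation using (Permutation′; _⟨$⟩ʳ_; _⟨$⟩ˡ_)
open import Data.List using (List; []; _∷_; foldr; map; upTo; length)
open import Data.List.Relation.Unary.All using (All)
open import Data.List.Membership.Propositional using (_∈_)
open import Data.Product using (_×_; ∃-syntax)
open import Data.Bool using (if_then_else_)
open import Function using (_∘_; id)
open import Relation.Nullary using (yes; no)
open import Relation.Binary.PropositionalEquality using (_≡_)

-- Conventions: permutations of S_m are library permutations of Fin m;
-- we read them in 1-indexed one-line notation on ℕ (positions and values 1..m).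

oneLine : ∀ {m} → Permutation′ m → ℕ → ℕ
oneLine π zero = zero
oneLine {m} π (suc j) with j <? m
... | yes p = suc (toℕ (π ⟨$⟩ʳ fromℕ< p))
... | no _ = suc j

oneLineInv : ∀ {m} → Permutation′ m → ℕ → ℕ
oneLineInv π zero = zero
oneLineInv {m} π (suc j) with j <? m
... | yes p = suc (toℕ (π ⟨$⟩ˡ fromℕ< p))
... | no _ = suc j

-- w ∈ S_N with N = suc n.  posTop w = w⁻¹(N)
posTop : ∀ {n} → Permutation′ (suc n) → ℕ
posTop {n} w = oneLineInv w (suc n)

-- w̄ ∈ S_{N-1}: delete the letter N from the one-line notation of w
bar : ∀ {n} → Permutation′ (suc n) → ℕ → ℕ
bar w i = if i <ᵇ posTop w then oneLine w i else oneLine w (suc i)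

sref : ℕ → ℕ → ℕ
sref k i = if i ≡ᵇ k then suc k else (if i ≡ᵇ suc k then k else i)

wordProd : List ℕ → ℕ → ℕ
wordProd ws = foldr (λ k f → sref k ∘ f) id ws

Represents : ℕ → (ℕ → ℕ) → List ℕ → Set
Represents n u ws = All (λ k → 1 ≤ k × k < n) ws × (∀ i → 1 ≤ i → i ≤ n → wordProd ws i ≡ u i)

Reduced : ℕ → (ℕ → ℕ) → List ℕ → Set
Reduced n u ws = Represents n u ws × (∀ ws' → Represents n u ws' → length ws ≤ length ws')

InSupp : ℕ → (ℕ → ℕ) → ℕ → Set
InSupp n u k = ∃[ ws ] (Reduced n u ws × k ∈ ws)

Mx : (ℕ → ℕ) → ℕ → ℕ
Mx u k = foldr _⊔_ 0 (map (λ j → u (suc j)) (upTo k))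

-- m_k(u) = min{u(k+1),...,u(n)}  for u ∈ S_n (initial value n+1 exceeds all values)
mn : ℕ → (ℕ → ℕ) → ℕ → ℕ
mn n u k = foldr _⊓_ (suc n) (map (λ j → u (suc (k + j))) (upTo (n ∸ k)))

NewRep : ∀ {n} → Permutation′ (suc n) → ℕ → Set
NewRep {n} w k = InSupp n (bar w) k × posTop w ≤ k

-- 𝔭_k(w), as a list of values (compared as sets)
pat : ∀ {n} → Permutation′ (suc n) → ℕ → List ℕ
pat {n} w k with posTop w <? oneLineInv w (Mx (bar w) k)
... | yes _ = suc n ∷ Mx (bar w) k ∷ mn n (bar w) k ∷ []
... | no _ with oneLineInv w (Mx (bar w) k) <? posTop w | mn n (bar w) k <? bar w k
...   | yes _ | yes _ = suc n ∷ bar w k ∷ mn n (bar w) k ∷ []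
...   | _ | _ = Mx (bar w) k ∷ suc n ∷ bar w k ∷ mn n (bar w) k ∷ []

SameSet : List ℕ → List ℕ → Set
SameSet xs ys = (∀ x → x ∈ xs → x ∈ ys) × (∀ x → x ∈ ys → x ∈ xs)

HasNOcc4321 : ∀ {n} → Permutation′ (suc n) → Set
HasNOcc4321 {n} w = ∃[ i₁ ] ∃[ i₂ ] ∃[ i₃ ] ∃[ i₄ ]
  (1 ≤ i₁ × i₁ < i₂ × i₂ < i₃ × i₃ < i₄ × i₄ ≤ suc n
   × oneLine w i₁ ≡ suc n
   × oneLine w i₂ < oneLine w i₁ × oneLine w i₃ < oneLine w i₂ × oneLine w i₄ < oneLine w i₃)

-- Let p = w⁻¹(N) ≤ k < k′ and write u = w̄.  The value u(k) lies in 𝔭_k(w) in cases (II) and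
-- (III), but cannot lie in 𝔭_k′(w): it is neither N, nor M_k′ (that would make the maximum M_k
-- sit at position k ≥ p, i.e. case (I)), nor u(k′), nor m_k′ = u(j′) with j′ > k′.  So k is in
-- case (I), and the same kind of argument puts k′ in case (I) too.  Then {N, M_k, m_k} =
-- {N, M_k′, m_k′} forces M_k = M_k′ = u(i) with p ≤ i ≤ k and m_k = m_k′ = u(j) with j > k′,
-- so N, u(i), u(k+1), u(j) is an N-occurrence of 4321 in w.
module Submission where

open import Defs
open import Data.Bool using (if_then_else_; true; false)
open import Data.Empty using (⊥-elim)
open import Data.Fin using (Fin; toℕ; fromℕ<)
open import Data.Fin.Properties using (toℕ<n; fromℕ<-toℕ; toℕ-fromℕ<)
open import Data.Fin.Permutation using (Permutation′; _⟨$⟩ʳ_; _⟨$⟩ˡ_; inverseˡ; flip)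
open import Data.List using (List; []; _∷_; foldr; map; upTo)
open import Data.List.Membership.Propositional using (_∈_)
open import Data.List.Membership.Propositional.Properties
  using (foldr-selective; ∈-map⁺; ∈-map⁻; ∈-upTo⁺; ∈-upTo⁻)
open import Data.List.Properties using (foldr-preservesᵒ)
open import Data.List.Relation.Unary.All using () renaming (lookup to All-lookup)
open import Data.List.Relation.Unary.Any as Any using (here; there)
open import Data.Nat using (ℕ; zero; suc; _≤_; _<_; _<ᵇ_; _⊔_; _⊓_; _∸_; _+_; z≤n; s≤s; s<s)
open import Data.Nat.Properties
open import Data.Product using (_×_; _,_; proj₁; proj₂; swap; uncurry; ∃-syntax)
open import Data.Sum using (inj₁; inj₂; [_,_])
open import Function using (_∘_)
open import Relation.Binary using (tri<; tri≈; tri>)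
open import Relation.Binary.PropositionalEquality
  using (_≡_; _≢_; refl; sym; trans; cong; subst; subst₂; module ≡-Reasoning)
open import Relation.Nullary using (¬_; yes; no)
open import Relation.Nullary.Decidable using (decidable-stable)

open ≡-Reasoning

oneLine-suc : ∀ {m} (π : Permutation′ m) {j} (j<m : j < m) →
              oneLine π (suc j) ≡ suc (toℕ (π ⟨$⟩ʳ fromℕ< j<m))
oneLine-suc {m} π {j} j<m with j <? m
... | yes _   = refl
... | no j≮m  = ⊥-elim (j≮m j<m)

oneLineInv≡oneLine-flip : ∀ {m} (π : Permutation′ m) x → oneLineInv π x ≡ oneLine (flip π) x
oneLineInv≡oneLine-flip π zero = refl
oneLineInv≡oneLine-flip {m} π (suc j) with j <? m
... | yes _ = refl
... | no _  = refl

oneLine-range : ∀ {m} (π : Permutation′ m) {x} → 1 ≤ x → x ≤ m →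
                1 ≤ oneLine π x × oneLine π x ≤ m
oneLine-range π {suc j} _ j<m rewrite oneLine-suc π j<m = s≤s z≤n , toℕ<n _

oneLineInv-range : ∀ {m} (π : Permutation′ m) {x} → 1 ≤ x → x ≤ m →
                   1 ≤ oneLineInv π x × oneLineInv π x ≤ m
oneLineInv-range π {x} 1≤x x≤m rewrite oneLineInv≡oneLine-flip π x = oneLine-range (flip π) 1≤x x≤m

oneLineInv-oneLine : ∀ {m} (π : Permutation′ m) {x} → 1 ≤ x → x ≤ m → oneLineInv π (oneLine π x) ≡ x
oneLineInv-oneLine {m} π {suc j} _ j<m = begin
  oneLineInv π (oneLine π (suc j))      ≡⟨ cong (oneLineInv π) (oneLine-suc π j<m) ⟩
  oneLineInv π (suc (toℕ y))            ≡⟨ oneLineInv≡oneLine-flip π _ ⟩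
  oneLine (flip π) (suc (toℕ y))        ≡⟨ oneLine-suc (flip π) (toℕ<n y) ⟩
  suc (toℕ (π ⟨$⟩ˡ fromℕ< (toℕ<n y)))   ≡⟨ cong (λ z → suc (toℕ (π ⟨$⟩ˡ z))) (fromℕ<-toℕ y _) ⟩
  suc (toℕ (π ⟨$⟩ˡ y))                  ≡⟨ cong (suc ∘ toℕ) (inverseˡ π) ⟩
  suc (toℕ (fromℕ< j<m))                ≡⟨ cong suc (toℕ-fromℕ< j<m) ⟩
  suc j                                 ∎
  where
  y : Fin m
  y = π ⟨$⟩ʳ fromℕ< j<m

oneLine-oneLineInv : ∀ {m} (π : Permutation′ m) {x} → 1 ≤ x → x ≤ m → oneLine π (oneLineInv π x) ≡ x
oneLine-oneLineInv π {x} 1≤x x≤m = begin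
  oneLine π (oneLineInv π x)                ≡⟨ oneLineInv≡oneLine-flip (flip π) (oneLineInv π x) ⟨
  oneLineInv (flip π) (oneLineInv π x)      ≡⟨ cong (oneLineInv (flip π)) (oneLineInv≡oneLine-flip π x) ⟩
  oneLineInv (flip π) (oneLine (flip π) x)  ≡⟨ oneLineInv-oneLine (flip π) 1≤x x≤m ⟩
  x                                         ∎

-- skip p is the increasing enumeration of ℕ ∖ {p}: position i of w̄ is position
-- skip (w⁻¹(N)) i of w.
skip : ℕ → ℕ → ℕ
skip p i = if i <ᵇ p then i else suc i

skip-< : ∀ {p i} → i < p → skip p i ≡ i
skip-< {p} {i} i<p with i <ᵇ p | <⇒<ᵇ i<p
... | true | _ = refl

skip-≥ : ∀ {p i} → p ≤ i → skip p i ≡ suc i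
skip-≥ {p} {i} p≤i with i <ᵇ p | <ᵇ⇒< i p
... | false | _   = refl
... | true  | i<p = ⊥-elim (<⇒≱ (i<p _) p≤i)

skip-range : ∀ p {i n} → 1 ≤ i → i ≤ n → 1 ≤ skip p i × skip p i ≤ suc n
skip-range p {i} 1≤i i≤n with i <? p
... | yes i<p rewrite skip-< i<p = 1≤i , m≤n⇒m≤1+n i≤n
... | no  i≮p rewrite skip-≥ (≮⇒≥ i≮p) = s≤s z≤n , s≤s i≤n

skip-mono-< : ∀ p {i j} → i < j → skip p i < skip p j
skip-mono-< p {i} {j} i<j with i <? p | j <? p
... | yes i<p | yes j<p rewrite skip-< i<p | skip-< j<p = i<j
... | yes i<p | no  j≮p rewrite skip-< i<p | skip-≥ (≮⇒≥ j≮p) = m<n⇒m<1+n i<j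
... | no  i≮p | no  j≮p rewrite skip-≥ (≮⇒≥ i≮p) | skip-≥ (≮⇒≥ j≮p) = s<s i<j
... | no  i≮p | yes j<p = ⊥-elim (i≮p (<-trans i<j j<p))

skip-injective : ∀ p {i j} → skip p i ≡ skip p j → i ≡ j
skip-injective p {i} {j} e with <-cmp i j
... | tri< i<j _ _ = ⊥-elim (<⇒≢ (skip-mono-< p i<j) e)
... | tri≈ _ i≡j _ = i≡j
... | tri> _ _ j<i = ⊥-elim (>⇒≢ (skip-mono-< p j<i) e)

skip≢ : ∀ p i → skip p i ≢ p
skip≢ p i with i <? p
... | yes i<p rewrite skip-< i<p = <⇒≢ i<p
... | no  i≮p rewrite skip-≥ (≮⇒≥ i≮p) = >⇒≢ (s≤s (≮⇒≥ i≮p))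

≤⇒<skip : ∀ {p i} → p ≤ i → p < skip p i
≤⇒<skip p≤i rewrite skip-≥ p≤i = s≤s p≤i

<skip⇒≤ : ∀ {p i} → p < skip p i → p ≤ i
<skip⇒≤ {p} {i} p<skip with i <? p
... | yes i<p rewrite skip-< i<p = ⊥-elim (<-asym i<p p<skip)
... | no  i≮p = ≮⇒≥ i≮p

∈⇒≤-foldr-⊔ : ∀ {x} d xs → x ∈ xs → x ≤ foldr _⊔_ d xs
∈⇒≤-foldr-⊔ {x} d xs x∈xs = foldr-preservesᵒ {P = x ≤_}
  (λ a b → [ m≤n⇒m≤n⊔o b , m≤n⇒m≤o⊔n a ]) d xs (inj₂ (Any.map ≤-reflexive x∈xs))

∈⇒foldr-⊓-≤ : ∀ {x} d xs → x ∈ xs → foldr _⊓_ d xs ≤ x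
∈⇒foldr-⊓-≤ {x} d xs x∈xs = foldr-preservesᵒ {P = _≤ x}
  (λ a b → [ m≤n⇒m⊓o≤n b , m≤n⇒o⊓m≤n a ]) d xs (inj₂ (Any.map (≤-reflexive ∘ sym) x∈xs))

Mx-upper : ∀ (u : ℕ → ℕ) {k i} → 1 ≤ i → i ≤ k → u i ≤ Mx u k
Mx-upper u {k} {suc i} _ i<k = ∈⇒≤-foldr-⊔ 0 _ (∈-map⁺ (λ j → u (suc j)) (∈-upTo⁺ i<k))

-- The fold starts from 0, so a maximum 0 is attained at i = 1.
Mx-attained : ∀ (u : ℕ → ℕ) {k} → 1 ≤ k → ∃[ i ] (1 ≤ i × i ≤ k × Mx u k ≡ u i)
Mx-attained u {k} 1≤k with foldr-selective ⊔-sel 0 (map (λ j → u (suc j)) (upTo k))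
... | inj₁ Mx≡0 =
  1 , ≤-refl , 1≤k , trans Mx≡0 (sym (n≤0⇒n≡0 (subst (u 1 ≤_) Mx≡0 (Mx-upper u ≤-refl 1≤k))))
... | inj₂ Mx∈ with ∈-map⁻ (λ j → u (suc j)) Mx∈
...   | j , j∈ , Mx≡uⱼ = suc j , s≤s z≤n , ∈-upTo⁻ j∈ , Mx≡uⱼ

mn-lower : ∀ n (u : ℕ → ℕ) {k j} → k < j → j ≤ n → mn n u k ≤ u j
mn-lower n u {k} {j} k<j j≤n =
  subst (λ z → mn n u k ≤ u z) 1+k+t≡j
    (∈⇒foldr-⊓-≤ (suc n) _ (∈-map⁺ (λ t → u (suc (k + t))) (∈-upTo⁺ t<n∸k)))
  where
  t : ℕ
  t = j ∸ suc k
  1+k+t≡j : suc (k + t) ≡ j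
  1+k+t≡j = m+[n∸m]≡n k<j
  t<n∸k : t < n ∸ k
  t<n∸k = m+n≤o⇒m≤o∸n (suc t)
            (subst (_≤ n) (cong suc (+-comm k t)) (subst (_≤ n) (sym 1+k+t≡j) j≤n))

mn-attained : ∀ n (u : ℕ → ℕ) {k} → k < n → (∀ {j} → 1 ≤ j → j ≤ n → u j ≤ n) →
              ∃[ j ] (k < j × j ≤ n × mn n u k ≡ u j)
mn-attained n u {k} k<n u≤n
  with foldr-selective ⊓-sel (suc n) (map (λ t → u (suc (k + t))) (upTo (n ∸ k)))
... | inj₁ mn≡1+n =
  ⊥-elim (1+n≰n (subst (_≤ n) mn≡1+n (≤-trans (mn-lower n u ≤-refl k<n) (u≤n (s≤s z≤n) k<n))))
... | inj₂ mn∈ with ∈-map⁻ (λ t → u (suc (k + t))) mn∈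
...   | t , t∈ , mn≡uⱼ = suc (k + t) , s≤s (m≤m+n k t) , 1+k+t≤n , mn≡uⱼ
  where
  1+k+t≤n : suc (k + t) ≤ n
  1+k+t≤n = subst (_≤ n) (cong suc (+-comm t k)) (m≤o∸n⇒m+n≤o (suc t) (<⇒≤ k<n) (∈-upTo⁻ t∈))

_⊆_ : List ℕ → List ℕ → Set
xs ⊆ ys = ∀ x → x ∈ xs → x ∈ ys

∷-swap-⊆ : ∀ {a b} xs → (a ∷ b ∷ xs) ⊆ (b ∷ a ∷ xs)
∷-swap-⊆ _ _ (here e)          = there (here e)
∷-swap-⊆ _ _ (there (here e))  = here e
∷-swap-⊆ _ _ (there (there x∈)) = there (there x∈)

module _ {n} (w : Permutation′ (suc n)) where

  bar≡oneLine∘skip : ∀ i → bar w i ≡ oneLine w (skip (posTop w) i)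
  bar≡oneLine∘skip i with i <ᵇ posTop w
  ... | true  = refl
  ... | false = refl

  posTop-range : 1 ≤ posTop w × posTop w ≤ suc n
  posTop-range = oneLineInv-range w (s≤s z≤n) ≤-refl

  oneLine-posTop : oneLine w (posTop w) ≡ suc n
  oneLine-posTop = oneLine-oneLineInv w (s≤s z≤n) ≤-refl

  bar-range : ∀ {i} → 1 ≤ i → i ≤ n → 1 ≤ bar w i × bar w i ≤ suc n
  bar-range {i} 1≤i i≤n rewrite bar≡oneLine∘skip i =
    uncurry (oneLine-range w) (skip-range (posTop w) 1≤i i≤n)

  oneLineInv-bar : ∀ {i} → 1 ≤ i → i ≤ n → oneLineInv w (bar w i) ≡ skip (posTop w) i
  oneLineInv-bar {i} 1≤i i≤n = begin
    oneLineInv w (bar w i)                      ≡⟨ cong (oneLineInv w) (bar≡oneLine∘skip i) ⟩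
    oneLineInv w (oneLine w (skip (posTop w) i)) ≡⟨ uncurry (oneLineInv-oneLine w) (skip-range (posTop w) 1≤i i≤n) ⟩
    skip (posTop w) i                           ∎

  bar-injective : ∀ {i j} → 1 ≤ i → i ≤ n → 1 ≤ j → j ≤ n → bar w i ≡ bar w j → i ≡ j
  bar-injective {i} {j} 1≤i i≤n 1≤j j≤n e = skip-injective (posTop w) (begin
    skip (posTop w) i       ≡⟨ oneLineInv-bar 1≤i i≤n ⟨
    oneLineInv w (bar w i)  ≡⟨ cong (oneLineInv w) e ⟩
    oneLineInv w (bar w j)  ≡⟨ oneLineInv-bar 1≤j j≤n ⟩
    skip (posTop w) j       ∎)

  bar-<⇒≢ : ∀ {i j} → 1 ≤ i → i < j → j ≤ n → bar w i ≢ bar w j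
  bar-<⇒≢ 1≤i i<j j≤n e =
    <⇒≢ i<j (bar-injective 1≤i (<⇒≤ (<-≤-trans i<j j≤n)) (≤-trans 1≤i (<⇒≤ i<j)) j≤n e)

  bar≢top : ∀ {i} → 1 ≤ i → i ≤ n → bar w i ≢ suc n
  bar≢top {i} 1≤i i≤n e = skip≢ (posTop w) i (begin
    skip (posTop w) i       ≡⟨ oneLineInv-bar 1≤i i≤n ⟨
    oneLineInv w (bar w i)  ≡⟨ cong (oneLineInv w) e ⟩
    posTop w                ∎)

  bar-≤ : ∀ {i} → 1 ≤ i → i ≤ n → bar w i ≤ n
  bar-≤ 1≤i i≤n = ≤-pred (≤∧≢⇒< (proj₂ (bar-range 1≤i i≤n)) (bar≢top 1≤i i≤n))

  ≤⇒posTop<oneLineInv-bar : ∀ {i} → 1 ≤ i → i ≤ n → posTop w ≤ i → posTop w < oneLineInv w (bar w i)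
  ≤⇒posTop<oneLineInv-bar 1≤i i≤n p≤i rewrite oneLineInv-bar 1≤i i≤n = ≤⇒<skip p≤i

  posTop<oneLineInv-bar⇒≤ : ∀ {i} → 1 ≤ i → i ≤ n → posTop w < oneLineInv w (bar w i) → posTop w ≤ i
  posTop<oneLineInv-bar⇒≤ 1≤i i≤n p< rewrite oneLineInv-bar 1≤i i≤n = <skip⇒≤ p<

  bar-321⇒4321 : ∀ {a b c} → posTop w ≤ a → a < b → b < c → c ≤ n →
                 bar w b < bar w a → bar w c < bar w b → HasNOcc4321 w
  bar-321⇒4321 {a} {b} {c} p≤a a<b b<c c≤n ub<ua uc<ub =
    posTop w , skip p a , skip p b , skip p c ,
    proj₁ posTop-range , ≤⇒<skip p≤a , skip-mono-< p a<b , skip-mono-< p b<c ,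
    proj₂ (skip-range p 1≤c c≤n) ,
    oneLine-posTop ,
    subst₂ _<_ (bar≡oneLine∘skip a) (sym oneLine-posTop) (s≤s (bar-≤ 1≤a a≤n)) ,
    subst₂ _<_ (bar≡oneLine∘skip b) (bar≡oneLine∘skip a) ub<ua ,
    subst₂ _<_ (bar≡oneLine∘skip c) (bar≡oneLine∘skip b) uc<ub
    where
    p : ℕ
    p = posTop w
    1≤a : 1 ≤ a
    1≤a = ≤-trans (proj₁ posTop-range) p≤a
    1≤c : 1 ≤ c
    1≤c = ≤-trans 1≤a (<⇒≤ (<-trans a<b b<c))
    a≤n : a ≤ n
    a≤n = <⇒≤ (<-trans a<b (<-≤-trans b<c c≤n))

module _ {n} (w : Permutation′ (suc n)) (k : ℕ) where

  CaseI : Set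
  CaseI = posTop w < oneLineInv w (Mx (bar w) k)

  pat-caseI : CaseI → pat w k ≡ suc n ∷ Mx (bar w) k ∷ mn n (bar w) k ∷ []
  pat-caseI I with posTop w <? oneLineInv w (Mx (bar w) k)
  ... | yes _ = refl
  ... | no ¬I = ⊥-elim (¬I I)

  bar∈pat-¬caseI : ¬ CaseI → bar w k ∈ pat w k × mn n (bar w) k ∈ pat w k
  bar∈pat-¬caseI ¬I with posTop w <? oneLineInv w (Mx (bar w) k)
  ... | yes I = ⊥-elim (¬I I)
  ... | no _ with oneLineInv w (Mx (bar w) k) <? posTop w | mn n (bar w) k <? bar w k
  ...   | yes _ | yes _ = there (here refl) , there (there (here refl))
  ...   | yes _ | no _  = there (there (here refl)) , there (there (there (here refl)))
  ...   | no _  | _     = there (there (here refl)) , there (there (there (here refl)))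

  pat⊆candidates : pat w k ⊆ (suc n ∷ Mx (bar w) k ∷ bar w k ∷ mn n (bar w) k ∷ [])
  pat⊆candidates with posTop w <? oneLineInv w (Mx (bar w) k)
  ... | yes _ = λ { _ (here e) → here e
                  ; _ (there (here e)) → there (here e)
                  ; _ (there (there (here e))) → there (there (there (here e)))
                  ; _ (there (there (there ()))) }
  ... | no _ with oneLineInv w (Mx (bar w) k) <? posTop w | mn n (bar w) k <? bar w k
  ...   | yes _ | yes _ = λ { _ (here e) → here e
                            ; _ (there (here e)) → there (there (here e))
                            ; _ (there (there (here e))) → there (there (there (here e)))
                            ; _ (there (there (there ()))) }
  ...   | yes _ | no _  = ∷-swap-⊆ (bar w k ∷ mn n (bar w) k ∷ [])
  ...   | no _  | _     = ∷-swap-⊆ (bar w k ∷ mn n (bar w) k ∷ [])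

module _ {n} (w : Permutation′ (suc n)) {i j j′ k k′ : ℕ}
         (1≤i : 1 ≤ i) (i≤k : i ≤ k) (k<j : k < j) (j≤n : j ≤ n)
         (k<k′ : k < k′) (k′<j′ : k′ < j′) (j′≤n : j′ ≤ n) (p≤k : posTop w ≤ k)
         (Mₖ≡uᵢ : Mx (bar w) k ≡ bar w i) (mₖ≡uⱼ : mn n (bar w) k ≡ bar w j)
         (mₖ′≡uⱼ′ : mn n (bar w) k′ ≡ bar w j′)
  where

  private
    u : ℕ → ℕ
    u = bar w

    1≤k : 1 ≤ k
    1≤k = ≤-trans 1≤i i≤k
    1≤k′ : 1 ≤ k′
    1≤k′ = ≤-trans 1≤k (<⇒≤ k<k′)
    1≤j : 1 ≤ j
    1≤j = ≤-trans 1≤k (<⇒≤ k<j)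
    1≤j′ : 1 ≤ j′
    1≤j′ = ≤-trans 1≤k′ (<⇒≤ k′<j′)
    k′≤n : k′ ≤ n
    k′≤n = <⇒≤ (<-≤-trans k′<j′ j′≤n)
    k≤n : k ≤ n
    k≤n = ≤-trans (<⇒≤ k<k′) k′≤n
    i≤n : i ≤ n
    i≤n = ≤-trans i≤k k≤n
    i<k′ : i < k′
    i<k′ = ≤-<-trans i≤k k<k′
    i<j : i < j
    i<j = ≤-<-trans i≤k k<j
    i<j′ : i < j′
    i<j′ = <-trans i<k′ k′<j′
    k<j′ : k < j′
    k<j′ = <-trans k<k′ k′<j′

    caseI⇒≤ : CaseI w k → posTop w ≤ i
    caseI⇒≤ I = posTop<oneLineInv-bar⇒≤ w 1≤i i≤n (subst (λ v → posTop w < oneLineInv w v) Mₖ≡uᵢ I)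

    ¬caseI⇒< : ¬ CaseI w k → i < posTop w
    ¬caseI⇒< ¬I = ≰⇒> λ p≤i → ¬I (subst (λ v → posTop w < oneLineInv w v) (sym Mₖ≡uᵢ)
                                           (≤⇒posTop<oneLineInv-bar w 1≤i i≤n p≤i))

  ¬caseIₖ : ¬ CaseI w k → ¬ (pat w k ⊆ pat w k′)
  ¬caseIₖ ¬I sub = excluded (pat⊆candidates w k′ _ (sub _ (proj₁ (bar∈pat-¬caseI w k ¬I))))
    where
    i<k : i < k
    i<k = <-≤-trans (¬caseI⇒< ¬I) p≤k
    excluded : ¬ (u k ∈ suc n ∷ Mx u k′ ∷ u k′ ∷ mn n u k′ ∷ [])
    excluded (here uₖ≡N) = bar≢top w 1≤k k≤n uₖ≡N
    excluded (there (here uₖ≡Mₖ′)) = bar-<⇒≢ w 1≤i i<k k≤n (≤-antisym uᵢ≤uₖ uₖ≤uᵢ)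
      where
      uᵢ≤uₖ : u i ≤ u k
      uᵢ≤uₖ = subst (u i ≤_) (sym uₖ≡Mₖ′) (Mx-upper u 1≤i (<⇒≤ i<k′))
      uₖ≤uᵢ : u k ≤ u i
      uₖ≤uᵢ = subst (u k ≤_) Mₖ≡uᵢ (Mx-upper u 1≤k ≤-refl)
    excluded (there (there (here uₖ≡uₖ′))) = bar-<⇒≢ w 1≤k k<k′ k′≤n uₖ≡uₖ′
    excluded (there (there (there (here uₖ≡mₖ′)))) = bar-<⇒≢ w 1≤k k<j′ j′≤n (trans uₖ≡mₖ′ mₖ′≡uⱼ′)

  caseIₖ : pat w k ⊆ pat w k′ → CaseI w k
  caseIₖ sub = decidable-stable (posTop w <? _) (λ ¬I → ¬caseIₖ ¬I sub)

  ¬caseIₖ′ : CaseI w k → ¬ CaseI w k′ → ¬ (pat w k′ ⊆ pat w k)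
  ¬caseIₖ′ I ¬I′ sub = excluded (into-pat-k (proj₁ mem))
    where
    mem : u k′ ∈ pat w k′ × mn n u k′ ∈ pat w k′
    mem = bar∈pat-¬caseI w k′ ¬I′
    into-pat-k : ∀ {x} → x ∈ pat w k′ → x ∈ suc n ∷ Mx u k ∷ mn n u k ∷ []
    into-pat-k x∈ = subst (_ ∈_) (pat-caseI w k I) (sub _ x∈)
    excludedMin : u k′ ≡ mn n u k → ¬ (mn n u k′ ∈ suc n ∷ Mx u k ∷ mn n u k ∷ [])
    excludedMin _ (here mₖ′≡N) = bar≢top w 1≤j′ j′≤n (trans (sym mₖ′≡uⱼ′) mₖ′≡N)
    excludedMin _ (there (here mₖ′≡Mₖ)) =
      bar-<⇒≢ w 1≤i i<j′ j′≤n (trans (sym Mₖ≡uᵢ) (trans (sym mₖ′≡Mₖ) mₖ′≡uⱼ′))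
    excludedMin uₖ′≡mₖ (there (there (here mₖ′≡mₖ))) =
      bar-<⇒≢ w 1≤k′ k′<j′ j′≤n (trans uₖ′≡mₖ (trans (sym mₖ′≡mₖ) mₖ′≡uⱼ′))
    excluded : ¬ (u k′ ∈ suc n ∷ Mx u k ∷ mn n u k ∷ [])
    excluded (here uₖ′≡N) = bar≢top w 1≤k′ k′≤n uₖ′≡N
    excluded (there (here uₖ′≡Mₖ)) = bar-<⇒≢ w 1≤i i<k′ k′≤n (sym (trans uₖ′≡Mₖ Mₖ≡uᵢ))
    excluded (there (there (here uₖ′≡mₖ))) = excludedMin uₖ′≡mₖ (into-pat-k (proj₂ mem))

  caseIₖ′ : pat w k ⊆ pat w k′ → pat w k′ ⊆ pat w k → CaseI w k′
  caseIₖ′ sub sub′ = decidable-stable (posTop w <? _) (λ ¬I′ → ¬caseIₖ′ (caseIₖ sub) ¬I′ sub′)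

  module _ (I : CaseI w k) (I′ : CaseI w k′) (sub : pat w k ⊆ pat w k′) where

    private
      caseI-⊆ : (suc n ∷ Mx u k ∷ mn n u k ∷ []) ⊆ (suc n ∷ Mx u k′ ∷ mn n u k′ ∷ [])
      caseI-⊆ x x∈ =
        subst (x ∈_) (pat-caseI w k′ I′) (sub x (subst (x ∈_) (sym (pat-caseI w k I)) x∈))

    Mxₖ≡Mxₖ′ : Mx u k ≡ Mx u k′
    Mxₖ≡Mxₖ′ with caseI-⊆ _ (there (here refl))
    ... | here Mₖ≡N = ⊥-elim (bar≢top w 1≤i i≤n (trans (sym Mₖ≡uᵢ) Mₖ≡N))
    ... | there (here Mₖ≡Mₖ′) = Mₖ≡Mₖ′
    ... | there (there (here Mₖ≡mₖ′)) =
      ⊥-elim (bar-<⇒≢ w 1≤i i<j′ j′≤n (trans (sym Mₖ≡uᵢ) (trans Mₖ≡mₖ′ mₖ′≡uⱼ′)))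

    argminₖ≡argminₖ′ : j ≡ j′
    argminₖ≡argminₖ′ with caseI-⊆ _ (there (there (here refl)))
    ... | here mₖ≡N = ⊥-elim (bar≢top w 1≤j j≤n (trans (sym mₖ≡uⱼ) mₖ≡N))
    ... | there (here mₖ≡Mₖ′) =
      ⊥-elim (bar-<⇒≢ w 1≤i i<j j≤n (trans (sym Mₖ≡uᵢ) (trans Mxₖ≡Mxₖ′ (trans (sym mₖ≡Mₖ′) mₖ≡uⱼ))))
    ... | there (there (here mₖ≡mₖ′)) =
      bar-injective w 1≤j j≤n 1≤j′ j′≤n (trans (sym mₖ≡uⱼ) (trans mₖ≡mₖ′ mₖ′≡uⱼ′))

  samePat⇒4321 : SameSet (pat w k) (pat w k′) → HasNOcc4321 w
  samePat⇒4321 (sub , sub′) = bar-321⇒4321 w (caseI⇒≤ I) (s≤s i≤k) 1+k<j j≤n uₖ₊₁<uᵢ uⱼ<uₖ₊₁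
    where
    I : CaseI w k
    I = caseIₖ sub
    I′ : CaseI w k′
    I′ = caseIₖ′ sub sub′
    1+k<j : suc k < j
    1+k<j = subst (suc k <_) (sym (argminₖ≡argminₖ′ I I′ sub)) (≤-<-trans k<k′ k′<j′)
    1+k≤n : suc k ≤ n
    1+k≤n = <⇒≤ (<-≤-trans 1+k<j j≤n)
    uₖ₊₁<uᵢ : u (suc k) < u i
    uₖ₊₁<uᵢ = ≤∧≢⇒<
      (subst (u (suc k) ≤_) (trans (sym (Mxₖ≡Mxₖ′ I I′ sub)) Mₖ≡uᵢ) (Mx-upper u (s≤s z≤n) k<k′))
      (bar-<⇒≢ w 1≤i (s≤s i≤k) 1+k≤n ∘ sym)
    uⱼ<uₖ₊₁ : u j < u (suc k)
    uⱼ<uₖ₊₁ = ≤∧≢⇒< (subst (_≤ u (suc k)) mₖ≡uⱼ (mn-lower n u ≤-refl 1+k≤n))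
                    (bar-<⇒≢ w (s≤s z≤n) 1+k<j j≤n ∘ sym)

newRep-bounds : ∀ {n} (w : Permutation′ (suc n)) {k} → NewRep w k → (1 ≤ k × k < n) × posTop w ≤ k
newRep-bounds w ((_ , ((s-range , _) , _) , sₖ∈) , p≤k) = All-lookup s-range sₖ∈ , p≤k

samePat⇒4321-ordered : ∀ {n} (w : Permutation′ (suc n)) {k k′} → NewRep w k → NewRep w k′ → k < k′ →
                       SameSet (pat w k) (pat w k′) → HasNOcc4321 w
samePat⇒4321-ordered {n} w {k} {k′} rₖ rₖ′ k<k′
  with newRep-bounds w rₖ | newRep-bounds w rₖ′
... | (1≤k , k<n) , p≤k | (_ , k′<n) , _
  with Mx-attained (bar w) 1≤k
     | mn-attained n (bar w) k<n (bar-≤ w)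
     | mn-attained n (bar w) k′<n (bar-≤ w)
... | i , 1≤i , i≤k , Mₖ≡uᵢ | j , k<j , j≤n , mₖ≡uⱼ | j′ , k′<j′ , j′≤n , mₖ′≡uⱼ′ =
  samePat⇒4321 w 1≤i i≤k k<j j≤n k<k′ k′<j′ j′≤n p≤k Mₖ≡uᵢ mₖ≡uⱼ mₖ′≡uⱼ′

proposition4p1p2 : ∀ {n} (w : Permutation′ (suc n)) (k k′ : ℕ)
    → NewRep w k → NewRep w k′ → k ≢ k′
    → SameSet (pat w k) (pat w k′)
    → HasNOcc4321 w
proposition4p1p2 w k k′ rₖ rₖ′ k≢k′ same with <-cmp k k′
... | tri< k<k′ _ _ = samePat⇒4321-ordered w rₖ rₖ′ k<k′ same
... | tri≈ _ k≡k′ _ = ⊥-elim (k≢k′ k≡k′)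
... | tri> _ _ k′<k = samePat⇒4321-ordered w rₖ′ rₖ k′<k (swap same)
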